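{- For all integers $h\ge1$ and $k\ge 2$, every deterministic $k$-way branching program of depth at most $2^h$ that computes $BT^h_2(k)$ (or that computes $FT^h_2(k)$) is thrifty.
   Context: For $h\ge1$, $T^h$ is the balanced binary tree with $h$ levels, with nodes numbered heap-style: root $1$, children of node $i$ are $2i$ and $2i+1$. Write $[k]=\{1,\dots,k\}$. An input $I$ consists of, for each internal node $i$, a function $f_i^I:[k]\times[k]\to[k]$ given as the $k^2$ input variables $f_i(a,b)\in[k]$, and for each leaf $i$ a variable $l_i\in[k]$. Node values: $v_i^I=l_i^I$ for leaves, $v_i^I=f_i^I(v_{2i}^I,v_{2i+1}^I)$ for internal nodes. $FT^h_2(k)$ maps $I$ to $v_1^I$; $BT^h_2(k)$ is the decision problem of whether $v_1^I=1$ (a program solves it if it computes its characteristic function). A deterministic $k$-way branching program computing $g:[k]^m\to R$ is a directed rooted multigraph whose nodes are called states, with a unique start state; every non-output state is labeled by an input variable and has exactly $k$ out-edges labeled $1,\dots,k$; there are $|R|$ sink output states labeled by the elements of $R$. On an input one follows from each state the edge labeled by the value of its variable; the computation path must end at the output state labeled by the correct value. The depth of such a program is the maximum, over all inputs, of the number of states on the computation path (including the output state). The program is thrifty if for every input $I$, every state on the computation path of $I$ that queries a variable $f_i(a,b)$ satisfies $a=v_{2i}^I$ and $b=v_{2i+1}^I$. -}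

module Defs where

open import Data.Nat using (ℕ; zero; suc; _+_; _*_; _∸_; _^_; _≤_; _<_)
open import Data.Nat.Logarithm using (⌊log₂_⌋)
open import Data.Fin using (Fin; toℕ)
open import Data.Bool using (Bool)
open import Data.Nat using (_≡ᵇ_)
open import Data.Sum using (_⊎_; inj₁; inj₂)
open import Data.Product using (Σ; _×_; _,_)
open import Data.Unit using (⊤)
open import Relation.Binary.PropositionalEquality using (_≡_)

-- [k] = {1,…,k} is represented by Fin k, via j ↦ j - 1
-- (so the element 1 of [k] is the Fin element with toℕ ≡ 0).

-- Input variables of T^h with values in [k], nodes numbered heap-style.
-- Internal nodes: 1 ≤ i < 2^(h-1); leaves: 2^(h-1) ≤ i < 2^h.
data Var (h k : ℕ) : Set where
  fvar : (i : ℕ) → 1 ≤ i → i < 2 ^ (h ∸ 1) → (a b : Fin k) → Var h k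
  lvar : (i : ℕ) → 2 ^ (h ∸ 1) ≤ i → i < 2 ^ h → Var h k

-- For convenience these are given as
-- total functions on ℕ; only the entries at actual nodes of T^h are ever
-- read (by the programs, via Var, and by the node values).
record Input (k : ℕ) : Set where
  field
    fs : ℕ → Fin k → Fin k → Fin k
    ls : ℕ → Fin k
open Input public

varVal : ∀ {h k} → Input k → Var h k → Fin k
varVal I (fvar i _ _ a b) = fs I i a b
varVal I (lvar i _ _)     = ls I i

-- value of node i whose subtree has r+1 levels
subVal : ∀ {k} → Input k → ℕ → ℕ → Fin k
subVal I zero    i = ls I i
subVal I (suc r) i = fs I i (subVal I r (2 * i)) (subVal I r (2 * i + 1))

-- v_i^I in T^h : node i is at depth ⌊log₂ i⌋, so its subtree has
-- h - ⌊log₂ i⌋ levels.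
nodeVal : ∀ {k} (h : ℕ) → Input k → ℕ → Fin k
nodeVal h I i = subVal I ((h ∸ 1) ∸ ⌊log₂ i ⌋) i

FT : ∀ {k} (h : ℕ) → Input k → Fin k
FT h I = nodeVal h I 1

BT : ∀ {k} (h : ℕ) → Input k → Bool
BT h I = toℕ (FT h I) ≡ᵇ 0

-- A deterministic k-way branching program over the variables of T^h with
-- output set R: n non-output states (Fin n), each labelled by a variable and
-- with k out-edges; exactly one sink output state per element of R
-- (output states are represented by the elements of R themselves).
record BP (h k n : ℕ) (R : Set) : Set where
  field
    start : Fin n ⊎ R
    query : Fin n → Var h k
    next  : Fin n → Fin k → Fin n ⊎ R
open BP public

-- From state s, on input I, the computation path has m states (including the
-- output state) and ends in output state r.
data Reaches {h k n : ℕ} {R : Set} (P : BP h k n R) (I : Input k)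
     : Fin n ⊎ R → ℕ → R → Set where
  done : ∀ r → Reaches P I (inj₂ r) 1 r
  step : ∀ q {m r} → Reaches P I (next P q (varVal I (query P q))) m r →
         Reaches P I (inj₁ q) (suc m) r

ComputesWithDepth≤ : ∀ {h k n : ℕ} {R : Set} → BP h k n R → (Input k → R) → ℕ → Set
ComputesWithDepth≤ {k = k} P g d =
  (I : Input k) → Σ ℕ λ m → m ≤ d × Reaches P I (start P) m (g I)

data OnPath {h k n : ℕ} {R : Set} (P : BP h k n R) (I : Input k) : Fin n → Set where
  here  : ∀ {q} → start P ≡ inj₁ q → OnPath P I q
  there : ∀ {q q'} → OnPath P I q →
          next P q (varVal I (query P q)) ≡ inj₁ q' → OnPath P I q'

ThriftyQuery : ∀ {h k} → Input k → Var h k → Set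
ThriftyQuery {h} I (fvar i _ _ a b) = (a ≡ nodeVal h I (2 * i)) × (b ≡ nodeVal h I (2 * i + 1))
ThriftyQuery I (lvar _ _ _) = ⊤

Thrifty : ∀ {h k n : ℕ} {R : Set} → BP h k n R → Set
Thrifty {k = k} P = (I : Input k) → ∀ q → OnPath P I q → ThriftyQuery I (query P q)

module Submission where

-- Fix an input I and write v_p for its node values.  The "base" probe J₀ of I
-- answers every unexpected entry f_p(x,y), i.e. (x,y) ≠ (v_2p, v_2p+1), with
-- other(v_p) ≠ v_p and leaves all expected entries and leaves alone; it has the
-- same node values as I.  The probe J_j of a node j additionally flips the
-- expected entry (or the leaf value) at j.  Then v_j changes in J_j, and since
-- unexpected entries answer other(v_p), the change climbs to the root, so the
-- program must answer differently on J₀ and J_j.  As J₀ and J_j differ only in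
-- the thrifty variable of node j, the path of J₀ queries a thrifty variable at
-- each of the 2^h − 1 nodes.  That path has at most 2^h − 1 queries, so by
-- pigeonhole all of them are thrifty.  Finally I agrees with J₀ on thrifty
-- variables, so the path of I is that of J₀, and it is thrifty too.

open import Data.Bool using (Bool)
open import Data.Empty using (⊥-elim)
open import Data.Fin as Fin using (Fin; toℕ)
open import Data.Fin.Properties using (injective⇒≤; toℕ-injective; toℕ<n)
open import Data.List using (List; []; _∷_; length; lookup)
open import Data.List.Relation.Unary.Any as Any using (Any; here; there)
open import Data.List.Relation.Unary.Any.Properties using (lookup-index)
open import Data.Maybe using (Maybe; nothing; just)
open import Data.Nat using (ℕ; zero; suc; pred; _+_; _*_; _∸_; _^_; _≤_; _<_; z≤n; s≤s; ⌊_/2⌋; _≡ᵇ_; _≟_; _<?_; >-nonZero)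
open import Data.Nat.Induction using (<-wellFounded)
open import Data.Nat.Logarithm using (⌊log₂_⌋; ⌊log₂⌋-mono-≤; ⌊log₂⌊n/2⌋⌋≡⌊log₂n⌋∸1; ⌊log₂[2^n]⌋≡n)
open import Data.Nat.Properties
open import Data.Product using (_×_; _,_; proj₁; proj₂)
open import Data.Sum using (inj₁)
open import Data.Unit using (tt)
open import Induction.WellFounded using (Acc; acc)
open import Relation.Binary.PropositionalEquality
open import Relation.Nullary using (¬_; Dec; yes; no)
open import Relation.Nullary.Decidable using (_×-dec_)
open import Defs

data Child (p : ℕ) : ℕ → Set where
  left  : Child p (2 * p)
  right : Child p (2 * p + 1)

child-of-half : ∀ c → Child ⌊ c /2⌋ c
child-of-half zero          = left
child-of-half (suc zero)    = right
child-of-half (suc (suc c)) = shift (child-of-half c)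
  where
  shift : ∀ {p c} → Child p c → Child (suc p) (suc (suc c))
  shift {p} left  = subst (Child (suc p)) (*-suc 2 p) left
  shift {p} right = subst (Child (suc p)) (cong (_+ 1) (*-suc 2 p)) right

half-of-child : ∀ {p c} → Child p c → ⌊ c /2⌋ ≡ p
half-of-child {zero}  left  = refl
half-of-child {zero}  right = refl
half-of-child {suc p} left  =
  trans (cong ⌊_/2⌋ (*-suc 2 p)) (cong suc (half-of-child {p} left))
half-of-child {suc p} right =
  trans (cong ⌊_/2⌋ (cong (_+ 1) (*-suc 2 p))) (cong suc (half-of-child {p} right))

double≤child : ∀ {p c} → Child p c → 2 * p ≤ c
double≤child left  = ≤-refl
double≤child right = m≤m+n _ 1

child≥2 : ∀ {p c} → 1 ≤ p → Child p c → 2 ≤ c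
child≥2 p≥1 ch = ≤-trans (*-monoʳ-≤ 2 p≥1) (double≤child ch)

log₂-child : ∀ {c} → 2 ≤ c → ⌊log₂ c ⌋ ≡ suc ⌊log₂ ⌊ c /2⌋ ⌋
log₂-child {c} 2≤c = begin
  ⌊log₂ c ⌋             ≡⟨ sym (suc-∸1 positive) ⟩
  suc (⌊log₂ c ⌋ ∸ 1)   ≡⟨ cong suc (sym (⌊log₂⌊n/2⌋⌋≡⌊log₂n⌋∸1 c)) ⟩
  suc ⌊log₂ ⌊ c /2⌋ ⌋   ∎
  where
  open ≡-Reasoning
  positive : 1 ≤ ⌊log₂ c ⌋
  positive = subst (_≤ ⌊log₂ c ⌋) (⌊log₂[2^n]⌋≡n 1) (⌊log₂⌋-mono-≤ 2≤c)
  suc-∸1 : ∀ {l} → 1 ≤ l → suc (l ∸ 1) ≡ l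
  suc-∸1 (s≤s _) = refl

log₂-of-child : ∀ {p c} → 1 ≤ p → Child p c → ⌊log₂ c ⌋ ≡ suc ⌊log₂ p ⌋
log₂-of-child p≥1 ch =
  trans (log₂-child (child≥2 p≥1 ch)) (cong (λ q → suc ⌊log₂ q ⌋) (half-of-child ch))

log₂-< : ∀ n {p} → 1 ≤ p → p < 2 ^ n → ⌊log₂ p ⌋ < n
log₂-< zero    (s≤s z≤n) (s≤s ())
log₂-< (suc n) {suc zero} _ _ = s≤s z≤n
log₂-< (suc n) {p@(suc (suc _))} _ p<2^[1+n] =
  subst (_< suc n) (sym (log₂-child {p} (s≤s (s≤s z≤n)))) (s≤s (log₂-< n (s≤s z≤n) half<2^n))
  where
  half<2^n : ⌊ p /2⌋ < 2 ^ n
  half<2^n = *-cancelˡ-< 2 _ _ (≤-<-trans (double≤child (child-of-half p)) p<2^[1+n])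

log₂-≥ : ∀ n {p} → 2 ^ n ≤ p → n ≤ ⌊log₂ p ⌋
log₂-≥ n {p} 2^n≤p = subst (_≤ ⌊log₂ p ⌋) (⌊log₂[2^n]⌋≡n n) (⌊log₂⌋-mono-≤ 2^n≤p)

height : ℕ → ℕ → ℕ
height h p = (h ∸ 1) ∸ ⌊log₂ p ⌋

height-child : ∀ h {p c} → 1 ≤ p → Child p c → height h c ≡ pred (height h p)
height-child h {p} p≥1 ch =
  trans (cong ((h ∸ 1) ∸_) (log₂-of-child p≥1 ch)) (sym (pred[m∸n]≡m∸[1+n] (h ∸ 1) ⌊log₂ p ⌋))

internal-height : ∀ h {p} → 1 ≤ p → p < 2 ^ (h ∸ 1) → 0 < height h p
internal-height h p≥1 p<2^[h-1] = m<n⇒0<n∸m (log₂-< (h ∸ 1) p≥1 p<2^[h-1])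

leaf-height : ∀ h {p} → 2 ^ (h ∸ 1) ≤ p → height h p ≡ 0
leaf-height h 2^[h-1]≤p = m≤n⇒m∸n≡0 (log₂-≥ (h ∸ 1) 2^[h-1]≤p)

parent-height : ∀ h {c} → 2 ≤ c → ⌊log₂ c ⌋ < h → 0 < height h ⌊ c /2⌋
parent-height h {c} 2≤c log<h =
  m<n⇒0<n∸m (∸-monoˡ-≤ 1 (subst (λ l → suc l ≤ h) (log₂-child 2≤c) log<h))

nodeVal-leaf : ∀ {k} h (K : Input k) {p} → height h p ≡ 0 → nodeVal h K p ≡ ls K p
nodeVal-leaf h K {p} height≡0 = cong (λ r → subVal K r p) height≡0

nodeVal-internal : ∀ {k} h (K : Input k) {p} → 1 ≤ p → 0 < height h p →
  nodeVal h K p ≡ fs K p (nodeVal h K (2 * p)) (nodeVal h K (2 * p + 1))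
nodeVal-internal h K {p} p≥1 positive = begin
  subVal K (height h p) p
    ≡⟨ cong (λ r → subVal K r p) (sym (suc-pred (height h p) ⦃ >-nonZero positive ⦄)) ⟩
  fs K p (subVal K below (2 * p)) (subVal K below (2 * p + 1))
    ≡⟨ cong₂ (fs K p) (at-child left) (at-child right) ⟩
  fs K p (nodeVal h K (2 * p)) (nodeVal h K (2 * p + 1)) ∎
  where
  open ≡-Reasoning
  below : ℕ
  below = pred (height h p)
  at-child : ∀ {c} → Child p c → subVal K below c ≡ nodeVal h K c
  at-child {c} ch = cong (λ r → subVal K r c) (sym (height-child h p≥1 ch))

values-agree : ∀ {k} h (I J : Input k) →
  (∀ p → 1 ≤ p → fs J p (nodeVal h I (2 * p)) (nodeVal h I (2 * p + 1))
                ≡ fs I p (nodeVal h I (2 * p)) (nodeVal h I (2 * p + 1))) →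
  (∀ p → ls J p ≡ ls I p) →
  ∀ {p} → 1 ≤ p → nodeVal h J p ≡ nodeVal h I p
values-agree h I J fs-agree ls-agree {p} = by-height (height h p) refl
  where
  open ≡-Reasoning
  by-height : ∀ r {p} → height h p ≡ r → 1 ≤ p → nodeVal h J p ≡ nodeVal h I p
  by-height zero {p} height≡0 _ =
    trans (nodeVal-leaf h J height≡0) (trans (ls-agree p) (sym (nodeVal-leaf h I height≡0)))
  by-height (suc r) {p} height≡1+r p≥1 = begin
    nodeVal h J p
      ≡⟨ nodeVal-internal h J p≥1 positive ⟩
    fs J p (nodeVal h J (2 * p)) (nodeVal h J (2 * p + 1))
      ≡⟨ cong₂ (fs J p) (at-child left) (at-child right) ⟩
    fs J p (nodeVal h I (2 * p)) (nodeVal h I (2 * p + 1))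
      ≡⟨ fs-agree p p≥1 ⟩
    fs I p (nodeVal h I (2 * p)) (nodeVal h I (2 * p + 1))
      ≡⟨ sym (nodeVal-internal h I p≥1 positive) ⟩
    nodeVal h I p ∎
    where
    positive : 0 < height h p
    positive = subst (0 <_) (sym height≡1+r) (s≤s z≤n)
    at-child : ∀ {c} → Child p c → nodeVal h J c ≡ nodeVal h I c
    at-child ch = by-height r (trans (height-child h p≥1 ch) (cong pred height≡1+r))
                              (<⇒≤ (child≥2 p≥1 ch))

vnode : ∀ {h k} → Var h k → ℕ
vnode (fvar i _ _ _ _) = i
vnode (lvar i _ _)     = i

-- A value different from a, chosen so that exactly one of a, other a is 1
-- (the element of Fin with toℕ ≡ 0).
other : ∀ {k} → Fin (suc (suc k)) → Fin (suc (suc k))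
other Fin.zero    = Fin.suc Fin.zero
other (Fin.suc _) = Fin.zero

other≢ : ∀ {k} (a : Fin (suc (suc k))) → other a ≢ a
other≢ Fin.zero    ()
other≢ (Fin.suc _) ()

isOne-other : ∀ {k} (a : Fin (suc (suc k))) → (toℕ a ≡ᵇ 0) ≢ (toℕ (other a) ≡ᵇ 0)
isOne-other Fin.zero    ()
isOne-other (Fin.suc _) ()

module Probing {k : ℕ} (h : ℕ) (I : Input (suc (suc k))) where

  K : ℕ
  K = suc (suc k)

  v : ℕ → Fin K
  v = nodeVal h I

  -- (x , y) are the true values of p's children: the only arguments at which
  -- a thrifty program may query f_p.
  Expected : ℕ → Fin K → Fin K → Set
  Expected p x y = (x ≡ v (2 * p)) × (y ≡ v (2 * p + 1))

  expected? : ∀ p x y → Dec (Expected p x y)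
  expected? p x y = (x Fin.≟ v (2 * p)) ×-dec (y Fin.≟ v (2 * p + 1))

  thrifty? : ∀ (x : Var h K) → Dec (ThriftyQuery I x)
  thrifty? (fvar i _ _ a b) = expected? i a b
  thrifty? (lvar _ _ _)     = yes tt

  flipped-child-unexpected : ∀ (J : Input K) {p c} → Child p c → nodeVal h J c ≡ other (v c) →
    ¬ Expected p (nodeVal h J (2 * p)) (nodeVal h J (2 * p + 1))
  flipped-child-unexpected J left  flipped (same , _) = other≢ _ (trans (sym flipped) same)
  flipped-child-unexpected J right flipped (_ , same) = other≢ _ (trans (sym flipped) same)

  AnswersOtherOffPath : Input K → Set
  AnswersOtherOffPath J = ∀ p x y → ¬ Expected p x y → fs J p x y ≡ other (v p)

  flip-parent : ∀ J → AnswersOtherOffPath J → ∀ {c} → 2 ≤ c → ⌊log₂ c ⌋ < h →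
    nodeVal h J c ≡ other (v c) → nodeVal h J ⌊ c /2⌋ ≡ other (v ⌊ c /2⌋)
  flip-parent J off-path {c} 2≤c log<h flipped =
    trans (nodeVal-internal h J (⌊n/2⌋-mono 2≤c) (parent-height h 2≤c log<h))
          (off-path _ _ _ (flipped-child-unexpected J (child-of-half c) flipped))

  flip-root : ∀ J → AnswersOtherOffPath J → ∀ {c} → 1 ≤ c → ⌊log₂ c ⌋ < h →
    nodeVal h J c ≡ other (v c) → nodeVal h J 1 ≡ other (v 1)
  flip-root J off-path = climb (<-wellFounded _)
    where
    climb : ∀ {c} → Acc _<_ c → 1 ≤ c → ⌊log₂ c ⌋ < h →
      nodeVal h J c ≡ other (v c) → nodeVal h J 1 ≡ other (v 1)
    climb {suc zero} _ _ _ flipped = flipped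
    climb {c@(suc (suc c′))} (acc smaller) _ log<h flipped =
      climb (smaller (⌊n/2⌋<n (suc c′))) (s≤s z≤n)
            (≤-<-trans (⌊log₂⌋-mono-≤ (⌊n/2⌋≤n c)) log<h)
            (flip-parent J off-path (s≤s (s≤s z≤n)) log<h flipped)

  flipAt : Maybe ℕ → ℕ → Fin K → Fin K
  flipAt nothing  p a = a
  flipAt (just j) p a with p ≟ j
  ... | yes _ = other a
  ... | no _  = a

  flipAt-here : ∀ j a → flipAt (just j) j a ≡ other a
  flipAt-here j a with j ≟ j
  ... | yes _  = refl
  ... | no j≢j = ⊥-elim (j≢j refl)

  flipAt-elsewhere : ∀ {j p} a → p ≢ j → flipAt (just j) p a ≡ a
  flipAt-elsewhere {j} {p} a p≢j with p ≟ j
  ... | yes p≡j = ⊥-elim (p≢j p≡j)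
  ... | no _    = refl

  probeFs : Maybe ℕ → ℕ → Fin K → Fin K → Fin K
  probeFs m p x y with expected? p x y
  ... | yes _ = flipAt m p (fs I p x y)
  ... | no _  = other (v p)

  probe : Maybe ℕ → Input K
  probe m = record { fs = probeFs m ; ls = λ p → flipAt m p (ls I p) }

  probe-unexpected : ∀ m → AnswersOtherOffPath (probe m)
  probe-unexpected m p x y unexpected with expected? p x y
  ... | yes e = ⊥-elim (unexpected e)
  ... | no _  = refl

  probe-expected : ∀ m p x y → Expected p x y → fs (probe m) p x y ≡ flipAt m p (fs I p x y)
  probe-expected m p x y e with expected? p x y
  ... | yes _          = refl
  ... | no unexpected = ⊥-elim (unexpected e)

  base-values : ∀ {p} → 1 ≤ p → nodeVal h (probe nothing) p ≡ v p
  base-values = values-agree h I (probe nothing)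
    (λ p _ → probe-expected nothing p _ _ (refl , refl)) (λ _ → refl)

  probe-flips-node : ∀ {j} → 1 ≤ j → nodeVal h (probe (just j)) j ≡ other (v j)
  probe-flips-node {j} j≥1 with j <? 2 ^ (h ∸ 1)
  ... | yes internal =
    trans (nodeVal-internal h probed j≥1 positive)
          (answer (expected? j (nodeVal h probed (2 * j)) (nodeVal h probed (2 * j + 1))))
    where
    probed : Input K
    probed = probe (just j)
    positive : 0 < height h j
    positive = internal-height h j≥1 internal
    answer : ∀ {x y} → Dec (Expected j x y) → fs probed j x y ≡ other (v j)
    answer {x} {y} (yes e) = begin
      fs probed j x y                            ≡⟨ probe-expected (just j) j x y e ⟩
      flipAt (just j) j (fs I j x y)             ≡⟨ flipAt-here j _ ⟩
      other (fs I j x y)                         ≡⟨ cong other (cong₂ (fs I j) (proj₁ e) (proj₂ e)) ⟩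
      other (fs I j (v (2 * j)) (v (2 * j + 1))) ≡⟨ cong other (sym (nodeVal-internal h I j≥1 positive)) ⟩
      other (v j)                                ∎
      where open ≡-Reasoning
    answer (no unexpected) = probe-unexpected (just j) j _ _ unexpected
  ... | no leaf = trans (nodeVal-leaf h (probe (just j)) {j} height≡0)
                        (trans (flipAt-here j (ls I j)) (cong other (sym (nodeVal-leaf h I {j} height≡0))))
    where
    height≡0 : height h j ≡ 0
    height≡0 = leaf-height h (≮⇒≥ leaf)

  probe-flips-root : ∀ {j} → 1 ≤ j → ⌊log₂ j ⌋ < h →
    nodeVal h (probe (just j)) 1 ≡ other (nodeVal h (probe nothing) 1)
  probe-flips-root j≥1 log<h =
    trans (flip-root (probe (just _)) (probe-unexpected (just _)) j≥1 log<h (probe-flips-node j≥1))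
          (cong other (sym (base-values {1} (s≤s z≤n))))

  ThriftyAt : ℕ → Var h K → Set
  ThriftyAt j x = (vnode x ≡ j) × ThriftyQuery I x

  base-agrees : ∀ (x : Var h K) → ThriftyQuery I x → varVal (probe nothing) x ≡ varVal I x
  base-agrees (fvar i _ _ a b) t = probe-expected nothing i a b t
  base-agrees (lvar _ _ _)     _ = refl

  probe-differs : ∀ j x → varVal (probe nothing) x ≢ varVal (probe (just j)) x → ThriftyAt j x
  probe-differs j x@(fvar i _ _ a b) differ = by-expectation (expected? i a b)
    where
    by-expectation : Dec (Expected i a b) → ThriftyAt j x
    by-expectation (no unexpected) =
      ⊥-elim (differ (trans (probe-unexpected nothing i a b unexpected)
                            (sym (probe-unexpected (just j) i a b unexpected))))
    by-expectation (yes e) with i ≟ j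
    ... | yes i≡j = i≡j , e
    ... | no i≢j  = ⊥-elim (differ (trans (probe-expected nothing i a b e)
                      (sym (trans (probe-expected (just j) i a b e) (flipAt-elsewhere _ i≢j)))))
  probe-differs j x@(lvar i _ _) differ = by-node (i ≟ j)
    where
    by-node : Dec (i ≡ j) → ThriftyAt j x
    by-node (yes i≡j) = i≡j , tt
    by-node (no i≢j)  = ⊥-elim (differ (sym (flipAt-elsewhere _ i≢j)))

distinct-witnesses : ∀ {A : Set} {M} (xs : List A) (Q : Fin M → A → Set) →
  (∀ {s t x} → Q s x → Q t x → s ≡ t) → (∀ t → Any (Q t) xs) → M ≤ length xs
distinct-witnesses xs Q exclusive witness =
  injective⇒≤ {f = λ t → Any.index (witness t)} λ {s} {t} same-index →
    exclusive (lookup-index (witness s))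
              (subst (Q t) (cong (lookup xs) (sym same-index)) (lookup-index (witness t)))

module Paths {h k n : ℕ} {R : Set} (P : BP h k n R) where

  states : ∀ {I s m r} → Reaches P I s m r → List (Fin n)
  states (done _)     = []
  states (step q run) = q ∷ states run

  length-states : ∀ {I s m r} (run : Reaches P I s m r) → suc (length (states run)) ≡ m
  length-states (done _)     = refl
  length-states (step q run) = cong suc (length-states run)

  distinguish : ∀ {I J s m m′ r r′} (run : Reaches P I s m r) → Reaches P J s m′ r′ → r ≢ r′ →
    Any (λ q → varVal I (query P q) ≢ varVal J (query P q)) (states run)
  distinguish (done _) (done _) r≢r′ = ⊥-elim (r≢r′ refl)
  distinguish {I} {J} (step q run) (step .q run′) r≢r′
    with varVal I (query P q) Fin.≟ varVal J (query P q)
  ... | yes same  = there (distinguish run (subst (λ a → Reaches P J (next P q a) _ _) (sym same) run′) r≢r′)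
  ... | no differ = here differ

  start-in-states : ∀ {I s q m r} → s ≡ inj₁ q → (run : Reaches P I s m r) → Any (q ≡_) (states run)
  start-in-states refl (step q _) = here refl

  next-in-states : ∀ {I s q q′ m r} (run : Reaches P I s m r) → Any (q ≡_) (states run) →
    next P q (varVal I (query P q)) ≡ inj₁ q′ → Any (q′ ≡_) (states run)
  next-in-states (step q run) (here refl)  moves = there (start-in-states moves run)
  next-in-states (step q run) (there q∈)   moves = there (next-in-states run q∈ moves)

  onPath-in-states : ∀ {I q m r} → OnPath P I q → (run : Reaches P I (start P) m r) → Any (q ≡_) (states run)
  onPath-in-states (here starts)    run = start-in-states starts run
  onPath-in-states (there on moves) run = next-in-states run (onPath-in-states on run) moves

  follow : ∀ {I J} → (∀ {q} → OnPath P J q → varVal I (query P q) ≡ varVal J (query P q)) →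
    ∀ {q} → OnPath P I q → OnPath P J q
  follow agree (here starts) = here starts
  follow agree (there {q} on moves) =
    there (follow agree on) (trans (cong (next P q) (sym (agree (follow agree on)))) moves)

FT-separates : ∀ {k} h (J J′ : Input (suc (suc k))) →
  nodeVal h J′ 1 ≡ other (nodeVal h J 1) → FT h J ≢ FT h J′
FT-separates h J J′ flipped same = other≢ (FT h J) (trans (sym flipped) (sym same))

BT-separates : ∀ {k} h (J J′ : Input (suc (suc k))) →
  nodeVal h J′ 1 ≡ other (nodeVal h J 1) → BT h J ≢ BT h J′
BT-separates h J J′ flipped same =
  isOne-other (FT h J) (trans same (cong (λ a → toℕ a ≡ᵇ 0) flipped))

module LowerBound {k n : ℕ} {R : Set} (h : ℕ) (P : BP h (suc (suc k)) n R)
                  (g : Input (suc (suc k)) → R) (computes : ComputesWithDepth≤ P g (2 ^ h))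
                  (separates : ∀ J J′ → nodeVal h J′ 1 ≡ other (nodeVal h J 1) → g J ≢ g J′) where
  open Paths P

  module OnInput (I : Input (suc (suc k))) where
    open Probing h I

    base : Input K
    base = probe nothing

    baseRun : Reaches P base (start P) (proj₁ (computes base)) (g base)
    baseRun = proj₂ (proj₂ (computes base))

    queries-node : ∀ j → 1 ≤ j → j < 2 ^ h → Any (λ q → ThriftyAt j (query P q)) (states baseRun)
    queries-node j j≥1 j<2^h =
      Any.map (probe-differs j _)
        (distinguish baseRun (proj₂ (proj₂ (computes (probe (just j)))))
          (separates base (probe (just j)) (probe-flips-root j≥1 (log₂-< h j≥1 j<2^h))))

    -- Index 0 stands for an unthrifty query, index j ≥ 1 for the thrifty query at node j;
    -- no variable plays two roles.
    Role : ℕ → Var h K → Set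
    Role zero    x = ¬ ThriftyQuery I x
    Role (suc j) x = ThriftyAt (suc j) x

    role-unique : ∀ {i j x} → Role i x → Role j x → i ≡ j
    role-unique {zero}  {zero}  _         _         = refl
    role-unique {zero}  {suc _} unthrifty (_ , t)   = ⊥-elim (unthrifty t)
    role-unique {suc _} {zero}  (_ , t)   unthrifty = ⊥-elim (unthrifty t)
    role-unique {suc _} {suc _} (at-i , _) (at-j , _) = trans (sym at-i) at-j

    -- The base path has fewer than 2^h queries, 2^h − 1 of which are the
    -- thrifty queries of the nodes: there is no room for an unthrifty one.
    base-path-thrifty : ∀ {q} → OnPath P base q → ThriftyQuery I (query P q)
    base-path-thrifty {q} on with thrifty? (query P q)
    ... | yes thrifty  = thrifty
    ... | no unthrifty = ⊥-elim (≤⇒≯ enough short)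
      where
      play : ∀ i → i < 2 ^ h → Any (λ s → Role i (query P s)) (states baseRun)
      play zero    _     = Any.map (λ { refl → unthrifty }) (onPath-in-states on baseRun)
      play (suc j) j<2^h = queries-node (suc j) (s≤s z≤n) j<2^h
      enough : 2 ^ h ≤ length (states baseRun)
      enough = distinct-witnesses _ (λ t s → Role (toℕ t) (query P s))
                 (λ r r′ → toℕ-injective (role-unique r r′)) (λ t → play (toℕ t) (toℕ<n t))
      short : length (states baseRun) < 2 ^ h
      short = subst (_≤ 2 ^ h) (sym (length-states baseRun)) (proj₁ (proj₂ (computes base)))

    -- I agrees with the base probe on thrifty variables, so it follows the base path.
    path-thrifty : ∀ q → OnPath P I q → ThriftyQuery I (query P q)
    path-thrifty q on =
      base-path-thrifty (follow (λ on′ → sym (base-agrees _ (base-path-thrifty on′))) on)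

  thrifty : Thrifty P
  thrifty = OnInput.path-thrifty

mainTheorem3 : (h k : ℕ) → 1 ≤ h → 2 ≤ k →
    ((n : ℕ) (P : BP h k n Bool) → ComputesWithDepth≤ P (BT h) (2 ^ h) → Thrifty P)
    × ((n : ℕ) (P : BP h k n (Fin k)) → ComputesWithDepth≤ P (FT h) (2 ^ h) → Thrifty P)
mainTheorem3 h zero          _ ()
mainTheorem3 h (suc zero)    _ (s≤s ())
mainTheorem3 h (suc (suc k)) _ _ =
  (λ n P computes → LowerBound.thrifty h P (BT h) computes (BT-separates h)) ,
  (λ n P computes → LowerBound.thrifty h P (FT h) computes (FT-separates h))
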